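{- Let $G=(V,E)$ be a directed acyclic graph with $V=\{v_1,\dots,v_n\}$ listed in a topological order, and let $E=E_1\cup E_2$ be an edge split of $G$. Let $u,v\in V$, and for $1\le i\le n$ let $\mathcal{P}_i$ be the family of all paths from $u$ to $v_i$ using only edges of $E_1$, $\mathcal{Q}_i$ the family of all paths from $v_i$ to $v$ using only edges of $E_2$, and $\mathcal{S}$ the family of all paths from $u$ to $v$ in $G$. Suppose $i$ is such that $\mathcal{P}_i\neq\emptyset$ and $\mathcal{Q}_i\neq\emptyset$. Then: (a) if $\mathrm{repr}_L(\mathcal{S})=e\in E_1$ and $u\neq v_i$, then $\mathrm{repr}_L(\mathcal{P}_i)=e$; (b) if $\mathrm{repr}_R(\mathcal{S})=e\in E_2$ and $v_i\neq v$, then $\mathrm{repr}_R(\mathcal{Q}_i)=e$.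
   Context: A path is a sequence of vertices $w_1,\dots,w_k$ with $(w_j,w_{j+1})\in E$ for all $j$; it is identified with its set of edges, and for every vertex there is a path of length $0$ from it to itself (with empty edge set). An edge split of $G$ is a partition $E=E_1\cup E_2$ ($E_1\cap E_2=\emptyset$) such that there are no vertices $x,y,z$ with $(x,y)\in E_2$ and $(y,z)\in E_1$. Let $E^+=E\cup\{\top,\bot\}$ where $\top,\bot$ are two new symbols. For a family $\mathcal{P}$ of paths all sharing the same start and end vertex: $\mathrm{repr}_L(\mathcal{P})=\bot$ if $\mathcal{P}=\emptyset$; $\mathrm{repr}_L(\mathcal{P})=\top$ if $\mathcal{P}\ne\emptyset$ and no edge belongs to all paths of $\mathcal{P}$; otherwise $\mathrm{repr}_L(\mathcal{P})$ is the edge belonging to all paths of $\mathcal{P}$ whose tail is minimum in the topological order. $\mathrm{repr}_R(\mathcal{P})$ is defined identically with "maximum" in place of "minimum". -}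

module Defs where

open import Data.Nat using (ℕ)
open import Data.Fin using (Fin; _<_; _≤_)
open import Data.Product using (Σ; _×_; ∃)
open import Data.Sum using (_⊎_)
open import Data.Empty using (⊥)
open import Relation.Nullary using (¬_)

-- A (simple) directed graph on vertex set Fin n is an edge relation
-- E x y meaning (x , y) ∈ E.  Edges are identified with vertex pairs.

module _ {n : ℕ} (E : Fin n → Fin n → Set) where

  data Path : Fin n → Fin n → Set where
    []  : ∀ {a} → Path a a
    _∷_ : ∀ {a b c} → E a b → Path b c → Path a c

  data InPath (x y : Fin n) : ∀ {a b} → Path a b → Set where
    here  : ∀ {c} (e : E x y) (p : Path y c) → InPath x y (e ∷ p)
    there : ∀ {a b c} (e : E a b) {p : Path b c} → InPath x y p → InPath x y (e ∷ p)

  AllEdgesIn : (F : Fin n → Fin n → Set) → ∀ {a b} → Path a b → Set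
  AllEdgesIn F p = ∀ x y → InPath x y p → F x y

  -- V = Fin n listed in topological order: every edge goes forward.
  -- (This also makes the graph acyclic.)
  TopologicallyOrdered : Set
  TopologicallyOrdered = ∀ x y → E x y → x < y

  IsEdgeSplit : (E₁ E₂ : Fin n → Fin n → Set) → Set
  IsEdgeSplit E₁ E₂ =
      (∀ x y → E x y → E₁ x y ⊎ E₂ x y)
    × (∀ x y → E₁ x y → E x y)
    × (∀ x y → E₂ x y → E x y)
    × (∀ x y → ¬ (E₁ x y × E₂ x y))
    × (∀ x y z → E₂ x y → E₁ y z → ⊥)

  Family : Fin n → Fin n → Set₁
  Family a b = Path a b → Set

  Common : ∀ {a b} → Family a b → Fin n → Fin n → Set
  Common 𝒫 x y = ∀ p → 𝒫 p → InPath x y p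

  NonEmpty : ∀ {a b} → Family a b → Set
  NonEmpty {a} {b} 𝒫 = Σ (Path a b) 𝒫

data E⁺ (n : ℕ) : Set where
  edge : Fin n → Fin n → E⁺ n
  top  : E⁺ n
  bot  : E⁺ n

module _ {n : ℕ} {E : Fin n → Fin n → Set} {a b : Fin n} where

  -- ReprL 𝒫 r  means  repr_L(𝒫) = r  (graph of the function repr_L)
  ReprL : Family E a b → E⁺ n → Set
  ReprL 𝒫 bot = ¬ NonEmpty E 𝒫
  ReprL 𝒫 top = NonEmpty E 𝒫 × (∀ x y → ¬ Common E 𝒫 x y)
  ReprL 𝒫 (edge x y) =
    NonEmpty E 𝒫 × Common E 𝒫 x y × (∀ x' y' → Common E 𝒫 x' y' → x ≤ x')

  ReprR : Family E a b → E⁺ n → Set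
  ReprR 𝒫 bot = ¬ NonEmpty E 𝒫
  ReprR 𝒫 top = NonEmpty E 𝒫 × (∀ x y → ¬ Common E 𝒫 x y)
  ReprR 𝒫 (edge x y) =
    NonEmpty E 𝒫 × Common E 𝒫 x y × (∀ x' y' → Common E 𝒫 x' y' → x' ≤ x)

-- Every u–v path meets the edge e of repr_L(𝒮) = e ∈ E₁, and the part of such a
-- path before e uses only E₁-edges, since an E₂-edge can never be followed by an
-- E₁-edge. Concatenating an E₁-path u → vᵢ with an E₂-path vᵢ → v gives a u–v path,
-- so e lies on every path of 𝒫ᵢ. Conversely an edge common to 𝒫ᵢ with tail before e
-- is common to 𝒮: reroute any u–v path after its visit to e along a fixed path of
-- 𝒫ᵢ; the rerouted path lies in 𝒫ᵢ, and the part after e only has tails ≥ tail(e).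
-- Part (b) is the mirror image.
module Submission where

open import Defs
open import Data.Nat using (ℕ)
open import Data.Nat.Properties using (≤-refl; ≤-trans; <⇒≤; <-≤-trans; <⇒≱; ≮⇒≥)
open import Data.Fin using (Fin; _<_; _≤_)
open import Data.Product using (Σ; ∃; _×_; _,_; proj₁; proj₂)
open import Data.Sum using (_⊎_; inj₁; inj₂)
open import Data.Empty using (⊥; ⊥-elim)
open import Data.Unit using (tt) renaming (⊤ to ⊤′)
open import Relation.Nullary using (¬_)
open import Relation.Binary.PropositionalEquality using (_≡_; refl; _≢_)

module _ {n : ℕ} {E : Fin n → Fin n → Set} where

  infixr 5 _++_

  _++_ : ∀ {a b c} → Path E a b → Path E b c → Path E a c
  [] ++ q = q
  (e ∷ p) ++ q = e ∷ (p ++ q)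

  AllPaths : ∀ {a b} → Family E a b
  AllPaths _ = ⊤′

  ∈-++⁺ˡ : ∀ {a b c x y} {p : Path E a b} (q : Path E b c) →
           InPath E x y p → InPath E x y (p ++ q)
  ∈-++⁺ˡ q (here e p) = here e (p ++ q)
  ∈-++⁺ˡ q (there e i) = there e (∈-++⁺ˡ q i)

  ∈-++⁺ʳ : ∀ {a b c x y} (p : Path E a b) {q : Path E b c} →
           InPath E x y q → InPath E x y (p ++ q)
  ∈-++⁺ʳ [] i = i
  ∈-++⁺ʳ (e ∷ p) i = there e (∈-++⁺ʳ p i)

  ∈-++⁻ : ∀ {a b c x y} (p : Path E a b) {q : Path E b c} →
          InPath E x y (p ++ q) → InPath E x y p ⊎ InPath E x y q
  ∈-++⁻ [] i = inj₂ i
  ∈-++⁻ (e ∷ p) (here .e .(p ++ _)) = inj₁ (here e p)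
  ∈-++⁻ (e ∷ p) (there .e i) with ∈-++⁻ p i
  ... | inj₁ i₁ = inj₁ (there e i₁)
  ... | inj₂ i₂ = inj₂ i₂

  ∈-split : ∀ {a c x y} {s : Path E a c} → InPath E x y s →
            Σ (Path E a x) λ pre → Σ (E x y) λ e → Σ (Path E y c) λ suf →
              s ≡ pre ++ e ∷ suf
  ∈-split (here e p) = [] , e , p , refl
  ∈-split (there e i) with ∈-split i
  ... | pre , e′ , suf , refl = e ∷ pre , e′ , suf , refl

  module _ {F : Fin n → Fin n → Set} where

    AllEdgesIn-∷ : ∀ {a b c} {e : E a b} {q : Path E b c} →
                   F a b → AllEdgesIn E F q → AllEdgesIn E F (e ∷ q)
    AllEdgesIn-∷ f _ _ _ (here _ _) = f
    AllEdgesIn-∷ _ all x y (there _ i) = all x y i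

    AllEdgesIn-++ : ∀ {a b c} (p : Path E a b) {q : Path E b c} →
                    AllEdgesIn E F p → AllEdgesIn E F q → AllEdgesIn E F (p ++ q)
    AllEdgesIn-++ p all-p all-q x y i with ∈-++⁻ p i
    ... | inj₁ i₁ = all-p x y i₁
    ... | inj₂ i₂ = all-q x y i₂

    AllEdgesIn-++⁻ˡ : ∀ {a b c} {p : Path E a b} (q : Path E b c) →
                      AllEdgesIn E F (p ++ q) → AllEdgesIn E F p
    AllEdgesIn-++⁻ˡ q all x y i = all x y (∈-++⁺ˡ q i)

    AllEdgesIn-++⁻ʳ : ∀ {a b c} (p : Path E a b) {q : Path E b c} →
                      AllEdgesIn E F (p ++ q) → AllEdgesIn E F q
    AllEdgesIn-++⁻ʳ p all x y i = all x y (∈-++⁺ʳ p i)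

  module _ {a b : Fin n} where

    Common-prefixes : ∀ {w x y} {𝒫 : Family E a w} →
                      Common E (AllPaths {a = a} {b = b}) x y →
                      (q : Path E w b) → ¬ InPath E x y q → Common E 𝒫 x y
    Common-prefixes x∈S q x∉q p _ with ∈-++⁻ p (x∈S (p ++ q) tt)
    ... | inj₁ x∈p = x∈p
    ... | inj₂ x∈q = ⊥-elim (x∉q x∈q)

    Common-suffixes : ∀ {w x y} {𝒬 : Family E w b} →
                      Common E (AllPaths {a = a} {b = b}) x y →
                      (p : Path E a w) → ¬ InPath E x y p → Common E 𝒬 x y
    Common-suffixes x∈S p x∉p q _ with ∈-++⁻ p (x∈S (p ++ q) tt)
    ... | inj₁ x∈p = ⊥-elim (x∉p x∈p)
    ... | inj₂ x∈q = x∈q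

module _ {n : ℕ} {E : Fin n → Fin n → Set} (topo : TopologicallyOrdered E) where

  source≤target : ∀ {a b} → Path E a b → a ≤ b
  source≤target [] = ≤-refl
  source≤target (e ∷ p) = ≤-trans (<⇒≤ (topo _ _ e)) (source≤target p)

  ∈⇒source≤tail : ∀ {a b x y} (p : Path E a b) → InPath E x y p → a ≤ x
  ∈⇒source≤tail (e ∷ p) (here .e .p) = ≤-refl
  ∈⇒source≤tail (e ∷ p) (there .e i) = ≤-trans (<⇒≤ (topo _ _ e)) (∈⇒source≤tail p i)

  ∈⇒tail<target : ∀ {a b x y} (p : Path E a b) → InPath E x y p → x < b
  ∈⇒tail<target (e ∷ p) (here .e .p) = <-≤-trans (topo _ _ e) (source≤target p)
  ∈⇒tail<target (e ∷ p) (there .e i) = ∈⇒tail<target p i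

module _ {n : ℕ} {E E₁ E₂ : Fin n → Fin n → Set} (split : IsEdgeSplit E E₁ E₂) where

  private
    cover : ∀ x y → E x y → E₁ x y ⊎ E₂ x y
    cover = proj₁ split

    disjoint : ∀ x y → ¬ (E₁ x y × E₂ x y)
    disjoint = proj₁ (proj₂ (proj₂ (proj₂ split)))

    no-turn : ∀ x y z → E₂ x y → E₁ y z → ⊥
    no-turn = proj₂ (proj₂ (proj₂ (proj₂ split)))

  E₁-before-E₁ : ∀ {a b c} → E a b → E₁ b c → E₁ a b
  E₁-before-E₁ e e₁ with cover _ _ e
  ... | inj₁ e₁′ = e₁′
  ... | inj₂ e₂ = ⊥-elim (no-turn _ _ _ e₂ e₁)

  E₂-after-E₂ : ∀ {a b c} → E₂ a b → E b c → E₂ b c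
  E₂-after-E₂ e₂ e with cover _ _ e
  ... | inj₁ e₁ = ⊥-elim (no-turn _ _ _ e₂ e₁)
  ... | inj₂ e₂′ = e₂′

  AllEdgesIn-E₁-before : ∀ {a x y} (p : Path E a x) → E₁ x y → AllEdgesIn E E₁ p
  AllEdgesIn-E₁-before p e₁ = proj₁ (go p e₁)
    where
    go : ∀ {a x y} (p : Path E a x) → E₁ x y → AllEdgesIn E E₁ p × ∃ (E₁ a)
    go [] e₁ = (λ _ _ ()) , _ , e₁
    go (e ∷ p) e₁ with go p e₁
    ... | all , _ , e₁′ = AllEdgesIn-∷ (E₁-before-E₁ e e₁′) all , _ , E₁-before-E₁ e e₁′

  AllEdgesIn-E₂-after : ∀ {x y c} → E₂ x y → (p : Path E y c) → AllEdgesIn E E₂ p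
  AllEdgesIn-E₂-after e₂ [] _ _ ()
  AllEdgesIn-E₂-after e₂ (e ∷ p) =
    AllEdgesIn-∷ (E₂-after-E₂ e₂ e) (AllEdgesIn-E₂-after (E₂-after-E₂ e₂ e) p)

  module _ (topo : TopologicallyOrdered E) {u v w x y : Fin n} where

    Common-E₁-prefixes-before⇒Common : ∀ {x′ y′} → E₁ x y →
      (p : Path E u w) → AllEdgesIn E E₁ p → InPath E x y p →
      Common E (AllPaths {a = u} {b = v}) x y →
      Common E (AllEdgesIn E E₁ {u} {w}) x′ y′ → x′ < x → Common E (AllPaths {a = u} {b = v}) x′ y′
    Common-E₁-prefixes-before⇒Common e₁ p p₁ x∈p x∈S x′∈P x′<x s _
      with ∈-split x∈p | ∈-split (x∈S s tt)
    ... | pre′ , e′ , suf′ , refl | pre , _ , _ , refl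
      with ∈-++⁻ pre (x′∈P (pre ++ e′ ∷ suf′)
                        (AllEdgesIn-++ pre (AllEdgesIn-E₁-before pre e₁) (AllEdgesIn-++⁻ʳ pre′ p₁)))
    ...   | inj₁ x′∈pre = ∈-++⁺ˡ _ x′∈pre
    ...   | inj₂ x′∈rest = ⊥-elim (<⇒≱ x′<x (∈⇒source≤tail topo (e′ ∷ suf′) x′∈rest))

    Common-E₂-suffixes-after⇒Common : ∀ {x′ y′} → E₂ x y →
      (q : Path E w v) → AllEdgesIn E E₂ q → InPath E x y q →
      Common E (AllPaths {a = u} {b = v}) x y →
      Common E (AllEdgesIn E E₂ {w} {v}) x′ y′ → x < x′ → Common E (AllPaths {a = u} {b = v}) x′ y′
    Common-E₂-suffixes-after⇒Common e₂ q q₂ x∈q x∈S x′∈Q x<x′ s _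
      with ∈-split x∈q | ∈-split (x∈S s tt)
    ... | pre′ , _ , _ , refl | pre , e , suf , refl
      with ∈-++⁻ pre′ (x′∈Q (pre′ ++ e ∷ suf)
                          (AllEdgesIn-++ pre′ (AllEdgesIn-++⁻ˡ _ q₂)
                             (AllEdgesIn-∷ e₂ (AllEdgesIn-E₂-after e₂ suf))))
    ...   | inj₁ x′∈pre′ = ⊥-elim (<⇒≱ x<x′ (<⇒≤ (∈⇒tail<target topo pre′ x′∈pre′)))
    ...   | inj₂ x′∈rest = ∈-++⁺ʳ pre x′∈rest

    ReprL-E₁-prefixes : E₁ x y →
      NonEmpty E (AllEdgesIn E E₁ {u} {w}) → NonEmpty E (AllEdgesIn E E₂ {w} {v}) →
      ReprL {E = E} (AllPaths {a = u} {b = v}) (edge x y) → ReprL (AllEdgesIn E E₁ {u} {w}) (edge x y)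
    ReprL-E₁-prefixes e₁ (p , p₁) (q , q₂) (_ , x∈S , minimal) = (p , p₁) , x∈P , minimal′
      where
      x∈P : Common E (AllEdgesIn E E₁ {u} {w}) x y
      x∈P = Common-prefixes x∈S q (λ x∈q → disjoint x y (e₁ , q₂ x y x∈q))

      minimal′ : ∀ x′ y′ → Common E (AllEdgesIn E E₁ {u} {w}) x′ y′ → x ≤ x′
      minimal′ x′ y′ x′∈P = ≮⇒≥ λ x′<x → <⇒≱ x′<x (minimal x′ y′
        (Common-E₁-prefixes-before⇒Common e₁ p p₁ (x∈P p p₁) x∈S x′∈P x′<x))

    ReprR-E₂-suffixes : E₂ x y →
      NonEmpty E (AllEdgesIn E E₁ {u} {w}) → NonEmpty E (AllEdgesIn E E₂ {w} {v}) →
      ReprR {E = E} (AllPaths {a = u} {b = v}) (edge x y) → ReprR (AllEdgesIn E E₂ {w} {v}) (edge x y)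
    ReprR-E₂-suffixes e₂ (p , p₁) (q , q₂) (_ , x∈S , maximal) = (q , q₂) , x∈Q , maximal′
      where
      x∈Q : Common E (AllEdgesIn E E₂ {w} {v}) x y
      x∈Q = Common-suffixes x∈S p (λ x∈p → disjoint x y (p₁ x y x∈p , e₂))

      maximal′ : ∀ x′ y′ → Common E (AllEdgesIn E E₂ {w} {v}) x′ y′ → x′ ≤ x
      maximal′ x′ y′ x′∈Q = ≮⇒≥ λ x<x′ → <⇒≱ x<x′ (maximal x′ y′
        (Common-E₂-suffixes-after⇒Common e₂ q q₂ (x∈Q q q₂) x∈S x′∈Q x<x′))

-- The hypotheses u ≢ w and w ≢ v are implied by the others (a path from a vertex
-- to itself is empty, so it cannot contain the common edge), hence unused.
lemma2 : (n : ℕ) (E E₁ E₂ : Fin n → Fin n → Set)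
    → TopologicallyOrdered E
    → IsEdgeSplit E E₁ E₂
    → (u v w : Fin n)
    → NonEmpty E {u} {w} (AllEdgesIn E E₁)
    → NonEmpty E {w} {v} (AllEdgesIn E E₂)
    → ((x y : Fin n) → E₁ x y
        → ReprL {E = E} {a = u} {b = v} (λ _ → ⊤′) (edge x y)
        → u ≢ w
        → ReprL {E = E} (AllEdgesIn E E₁ {u} {w}) (edge x y))
    × ((x y : Fin n) → E₂ x y
        → ReprR {E = E} {a = u} {b = v} (λ _ → ⊤′) (edge x y)
        → w ≢ v
        → ReprR {E = E} (AllEdgesIn E E₂ {w} {v}) (edge x y))
lemma2 n E E₁ E₂ topo split u v w 𝒫-nonempty 𝒬-nonempty =
    (λ x y e₁ repr _ → ReprL-E₁-prefixes split topo e₁ 𝒫-nonempty 𝒬-nonempty repr)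
  , (λ x y e₂ repr _ → ReprR-E₂-suffixes split topo e₂ 𝒫-nonempty 𝒬-nonempty repr)
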